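{- For all integers $n$ and $k$ with $2\leq k\leq \lfloor n/2\rfloor$ there exists a graph $G$ of order $n$ with $$\delta(G)=\left\lceil \frac{n}{2}\right\rceil+\left\lfloor \frac{k}{2}\right\rfloor-2$$ such that $G$ is not a $k$-ordered Hamiltonian graph.
   Context: $\delta(G)$ denotes the minimum degree of $G$. A graph is Hamiltonian if it contains a cycle through all its vertices. For a sequence $S=v_1,\ldots,v_k$ of $k$ distinct vertices, a cycle is an $S$-cycle if it encounters $v_1,\ldots,v_k$ in this order. A Hamiltonian graph $G$ of order $n$ is $k$-ordered if for every sequence $S$ of $k$ distinct vertices of $G$ there is a Hamiltonian cycle of $G$ that is an $S$-cycle; "$k$-ordered Hamiltonian graph" means a Hamiltonian graph which is $k$-ordered. -}

module Defs where

open import Data.Nat using (ℕ; zero; suc; _+_; _<_; _≤_)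
open import Data.Bool using (Bool; true; false; if_then_else_)
open import Data.Fin using (Fin; toℕ)
open import Data.List using (List; map; allFin)
open import Data.Nat.ListAction using (sum)
open import Data.Product using (Σ; _×_; ∃; ∃-syntax)
open import Data.Sum using (_⊎_)
open import Function.Definitions using (Injective)
open import Relation.Binary.PropositionalEquality using (_≡_)
open import Relation.Nullary using (¬_)

record Graph (n : ℕ) : Set where
  field
    adj    : Fin n → Fin n → Bool
    sym    : ∀ u v → adj u v ≡ adj v u
    irrefl : ∀ v → adj v v ≡ false
open Graph public

degree : ∀ {n} → Graph n → Fin n → ℕ
degree {n} G v = sum (map (λ w → if adj G v w then 1 else 0) (allFin n))

MinDegree : ∀ {n} → Graph n → ℕ → Set
MinDegree G d = (∀ v → d ≤ degree G v) × (∃[ v ] degree G v ≡ d)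

-- A Hamiltonian cycle, given as a cyclic enumeration σ(0),σ(1),…,σ(n-1)
-- of all vertices (σ injective, hence a bijection of Fin n) in which
-- consecutive vertices, and σ(n-1),σ(0), are adjacent.
-- (n ≥ 3 is needed for this to be a genuine cycle.)
IsHamCycle : ∀ {n} → Graph n → (Fin n → Fin n) → Set
IsHamCycle {n} G σ =
  (3 ≤ n) ×
  (Injective _≡_ _≡_ σ) ×
  (∀ (i j : Fin n) → toℕ j ≡ suc (toℕ i) → adj G (σ i) (σ j) ≡ true) ×
  (∀ (i j : Fin n) → toℕ i ≡ 0 → suc (toℕ j) ≡ n → adj G (σ j) (σ i) ≡ true)

Hamiltonian : ∀ {n} → Graph n → Set
Hamiltonian {n} G = ∃[ σ ] IsHamCycle G σ

-- The cycle σ is an S-cycle for S = v_1,…,v_k: traversing the cycle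
-- (in the direction of σ) from some start position s, the vertices
-- v_1,…,v_k are met at strictly increasing offsets d_1 < … < d_k < n,
-- i.e. v_j = σ((s + d_j) mod n).
IsSCycle : ∀ {n k} → (Fin n → Fin n) → (Fin k → Fin n) → Set
IsSCycle {n} {k} σ S =
  Σ (Fin n) λ s → Σ (Fin k → ℕ) λ d →
    (∀ j → d j < n) ×
    (∀ (i j : Fin k) → toℕ i < toℕ j → d i < d j) ×
    (∀ j → ∃[ p ] ((toℕ p ≡ toℕ s + d j ⊎ toℕ p + n ≡ toℕ s + d j) × σ p ≡ S j))

KOrderedHamiltonian : ∀ {n} → ℕ → Graph n → Set
KOrderedHamiltonian {n} k G =
  Hamiltonian G ×
  (∀ (S : Fin k → Fin n) → Injective _≡_ _≡_ S →
     ∃[ σ ] (IsHamCycle G σ × IsSCycle σ S))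

{-# OPTIONS --safe #-}
-- The graph is K_c joined to two disjoint cliques, for the odd number c = 2⌊k/2⌋ − 1:
-- the hub {0, …, c − 1} is adjacent to everything, and two vertices outside it are
-- adjacent iff they have the same parity.  A vertex outside the hub sees the hub and
-- about half of the rest, which gives the minimum degree c − 1 + ⌊(n − c)/2⌋.
-- The sequence S = c, c + 1, … defeats k-orderedness: cyclically consecutive entries
-- among S_0, …, S_c have different parities and edges off the hub preserve parity,
-- so a Hamiltonian S-cycle visits the hub strictly between any two of them.  These
-- c + 1 visits happen within one turn of the cycle, hence at distinct vertices, but
-- the hub has only c.
module Submission where

open import Defs hiding (sym)
open import Data.Bool using (Bool; true; false; not; _∧_; if_then_else_)
open import Data.Empty using (⊥)
open import Data.Fin as Fin using (Fin; zero; suc; toℕ; fromℕ; fromℕ<; inject₁; inject≤; _↑ʳ_)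
open import Data.Fin.Properties
  using (toℕ-fromℕ; toℕ-fromℕ<; toℕ-inject₁; toℕ-inject≤; toℕ-↑ʳ; toℕ<n; toℕ-injective;
         inject≤-injective; ↑ʳ-injective; pigeonhole)
open import Data.List using (tabulate)
open import Data.List.Properties using (map-tabulate; tabulate-cong)
open import Data.Nat
  using (ℕ; zero; suc; _+_; _*_; _∸_; _≤_; _<_; z≤n; s≤s; s≤s⁻¹; ⌊_/2⌋; ⌈_/2⌉;
         NonZero; >-nonZero; _%_; _/_; parity)
open import Data.Nat.DivMod
open import Data.Nat.ListAction using (sum)
open import Data.Nat.Properties
open import Data.Parity.Base using (0ℙ; 1ℙ; _⁻¹)
open import Data.Parity.Properties as ℙ using (p≢p⁻¹; p+p≡0ℙ; +-homo-+; suc-homo-⁻¹; ⁻¹-selfInverse)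
open import Data.Product using (∃-syntax; _×_; _,_; proj₁; proj₂)
open import Data.Sum using (_⊎_; inj₁; inj₂)
open import Function using (_∘_; id; flip; _⇔_; mk⇔; Equivalence)
open import Function.Definitions using (Injective)
open import Relation.Binary.PropositionalEquality
open import Relation.Nullary using (¬_; Dec; yes; no; does; ¬?; contradiction)
open import Relation.Nullary.Decidable using (_×-dec_; _⊎-dec_; dec-true; dec-false; does-⇔)

-- Counting

indicator : Bool → ℕ
indicator b = if b then 1 else 0

count : (ℕ → Bool) → ℕ → ℕ
count p zero    = 0
count p (suc n) = indicator (p 0) + count (p ∘ suc) n

count-cong : ∀ {p q} n → (∀ y → p y ≡ q y) → count p n ≡ count q n
count-cong zero    eq = refl
count-cong (suc n) eq = cong₂ _+_ (cong indicator (eq 0)) (count-cong n (eq ∘ suc))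

count-+ : ∀ p m n → count p (m + n) ≡ count p m + count (λ y → p (m + y)) n
count-+ p zero    n = refl
count-+ p (suc m) n = trans (cong (_ +_) (count-+ (p ∘ suc) m n))
  (sym (+-assoc (indicator (p 0)) (count (p ∘ suc) m) _))

count-all : ∀ {p} n → (∀ y → y < n → p y ≡ true) → count p n ≡ n
count-all zero    _   = refl
count-all (suc n) all rewrite all 0 (s≤s z≤n) = cong suc (count-all n (λ y y<n → all (suc y) (s≤s y<n)))

count-remove : ∀ p x n → x < n → p x ≡ true →
               suc (count (λ y → not (does (x ≟ y)) ∧ p y) n) ≡ count p n
count-remove p zero    (suc n) _         p0 rewrite p0 = refl
count-remove p (suc x) (suc n) (s≤s x<n) px =
  trans (sym (+-suc _ _)) (cong (_ +_) (count-remove (p ∘ suc) x n x<n px))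

Alternating : (ℕ → Bool) → Set
Alternating p = ∀ y → p (suc y) ≡ not (p y)

count-alternating-false : ∀ {p} → Alternating p → p 0 ≡ false → ∀ n → count p n ≡ ⌊ n /2⌋
count-alternating-true  : ∀ {p} → Alternating p → p 0 ≡ true  → ∀ n → count p n ≡ ⌈ n /2⌉

count-alternating-false alt p0 zero    = refl
count-alternating-false alt p0 (suc n) rewrite p0 =
  count-alternating-true (alt ∘ suc) (trans (alt 0) (cong not p0)) n

count-alternating-true alt p0 zero    = refl
count-alternating-true alt p0 (suc n) rewrite p0 =
  cong suc (count-alternating-false (alt ∘ suc) (trans (alt 0) (cong not p0)) n)

count-alternating-≥ : ∀ {p} → Alternating p → ∀ n → ⌊ n /2⌋ ≤ count p n
count-alternating-≥ {p} alt n with p 0 in p0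
... | false = ≤-reflexive (sym (count-alternating-false alt p0 n))
... | true  = ≤-trans (⌊n/2⌋≤⌈n/2⌉ n) (≤-reflexive (sym (count-alternating-true alt p0 n)))

degree≡count : ∀ {n} (G : Graph n) v (p : ℕ → Bool) → (∀ w → adj G v w ≡ p (toℕ w)) →
               degree G v ≡ count p n
degree≡count {n} G v p adj≡p = begin
  degree G v
    ≡⟨ cong sum (map-tabulate id (indicator ∘ adj G v)) ⟩
  sum (tabulate {n = n} (indicator ∘ adj G v))
    ≡⟨ cong sum (tabulate-cong (cong indicator ∘ adj≡p)) ⟩
  sum (tabulate {n = n} (indicator ∘ p ∘ toℕ))
    ≡⟨ sum-tabulate n p ⟩
  count p n
    ∎
  where
  open ≡-Reasoning
  sum-tabulate : ∀ n p → sum (tabulate {n = n} (indicator ∘ p ∘ toℕ)) ≡ count p n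
  sum-tabulate zero    p = refl
  sum-tabulate (suc n) p = cong (_ +_) (sum-tabulate n (p ∘ suc))

-- The hub graph

parity-suc : ∀ n → parity (suc n) ≡ parity n ⁻¹
parity-suc n = sym (⁻¹-selfInverse (suc-homo-⁻¹ n))

parity-suc-≢ : ∀ n → parity (suc n) ≢ parity n
parity-suc-≢ n eq = p≢p⁻¹ (parity n) (trans (sym eq) (parity-suc n))

parity-double : ∀ n → parity (n + n) ≡ 0ℙ
parity-double n = trans (+-homo-+ n n) (p+p≡0ℙ (parity n))

does-≟-⁻¹ : ∀ p q → does (p ℙ.≟ q ⁻¹) ≡ not (does (p ℙ.≟ q))
does-≟-⁻¹ 0ℙ 0ℙ = refl
does-≟-⁻¹ 0ℙ 1ℙ = refl
does-≟-⁻¹ 1ℙ 0ℙ = refl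
does-≟-⁻¹ 1ℙ 1ℙ = refl

sameParity-alternating : ∀ x c → Alternating (λ y → does (parity x ℙ.≟ parity (c + y)))
sameParity-alternating x c y = begin
  does (parity x ℙ.≟ parity (c + suc y))       ≡⟨ cong (λ z → does (parity x ℙ.≟ parity z)) (+-suc c y) ⟩
  does (parity x ℙ.≟ parity (suc (c + y)))     ≡⟨ cong (λ q → does (parity x ℙ.≟ q)) (parity-suc (c + y)) ⟩
  does (parity x ℙ.≟ parity (c + y) ⁻¹)        ≡⟨ does-≟-⁻¹ (parity x) (parity (c + y)) ⟩
  not (does (parity x ℙ.≟ parity (c + y)))     ∎
  where open ≡-Reasoning

Joined : ℕ → ℕ → ℕ → Set
Joined c x y = x < c ⊎ y < c ⊎ parity x ≡ parity y

joined? : ∀ c x y → Dec (Joined c x y)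
joined? c x y = x <? c ⊎-dec y <? c ⊎-dec parity x ℙ.≟ parity y

Joined-sym : ∀ {c x y} → Joined c x y → Joined c y x
Joined-sym (inj₁ x<c)        = inj₂ (inj₁ x<c)
Joined-sym (inj₂ (inj₁ y<c)) = inj₁ y<c
Joined-sym (inj₂ (inj₂ eq))  = inj₂ (inj₂ (sym eq))

Joined⇔sameParity : ∀ {c x y} → c ≤ x → c ≤ y → Joined c x y ⇔ parity x ≡ parity y
Joined⇔sameParity {c} {x} {y} c≤x c≤y = mk⇔ to (inj₂ ∘ inj₂)
  where
  to : Joined c x y → parity x ≡ parity y
  to (inj₁ x<c)        = contradiction c≤x (<⇒≱ x<c)
  to (inj₂ (inj₁ y<c)) = contradiction c≤y (<⇒≱ y<c)
  to (inj₂ (inj₂ eq))  = eq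

Adjacent : ℕ → ℕ → ℕ → Set
Adjacent c x y = x ≢ y × Joined c x y

adjacent? : ∀ c x y → Dec (Adjacent c x y)
adjacent? c x y = ¬? (x ≟ y) ×-dec joined? c x y

Adjacent-sym : ∀ {c x y} → Adjacent c x y → Adjacent c y x
Adjacent-sym (x≢y , joined) = ≢-sym x≢y , Joined-sym joined

hubGraph : ℕ → ∀ n → Graph n
hubGraph c n = record
  { adj    = λ u v → does (adjacent? c (toℕ u) (toℕ v))
  ; sym    = λ u v → does-⇔ (mk⇔ Adjacent-sym Adjacent-sym) (adjacent? c _ _) (adjacent? c _ _)
  ; irrefl = λ v → dec-false (adjacent? c _ _) (λ (x≢x , _) → x≢x refl)
  }

hubGraph-edge-parity : ∀ {c x y} → c ≤ x → c ≤ y → does (adjacent? c x y) ≡ true → parity x ≡ parity y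
hubGraph-edge-parity {c} {x} {y} c≤x c≤y edge =
  Equivalence.to (Joined⇔sameParity c≤x c≤y) (proj₂ (witness (adjacent? c x y) edge))
  where
  witness : ∀ {A : Set} (a? : Dec A) → does a? ≡ true → A
  witness (yes a) _  = a
  witness (no _)  ()

count-joined≡count-sameParity : ∀ {c x} → c ≤ x → ∀ b →
  count (λ y → does (joined? c x (c + y))) b ≡ count (λ y → does (parity x ℙ.≟ parity (c + y))) b
count-joined≡count-sameParity {c} {x} c≤x b = count-cong b λ y →
  does-⇔ (Joined⇔sameParity c≤x (m≤m+n c y)) (joined? c x (c + y)) (parity x ℙ.≟ parity (c + y))

count-joined-beyond-≥ : ∀ c x b → ⌊ b /2⌋ ≤ count (λ y → does (joined? c x (c + y))) b
count-joined-beyond-≥ c x b with x <? c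
... | yes x<c = begin
  ⌊ b /2⌋                                      ≤⟨ ⌊n/2⌋≤n b ⟩
  b                                            ≡⟨ count-all b (λ y _ → dec-true (joined? c x (c + y)) (inj₁ x<c)) ⟨
  count (λ y → does (joined? c x (c + y))) b   ∎
  where open ≤-Reasoning
... | no  x≮c = begin
  ⌊ b /2⌋                                                  ≤⟨ count-alternating-≥ (sameParity-alternating x c) b ⟩
  count (λ y → does (parity x ℙ.≟ parity (c + y))) b      ≡⟨ count-joined≡count-sameParity (≮⇒≥ x≮c) b ⟨
  count (λ y → does (joined? c x (c + y))) b               ∎
  where open ≤-Reasoning

count-joined-beyond-≡ : ∀ {c x} → c ≤ x → parity x ≢ parity c → ∀ b →
                        count (λ y → does (joined? c x (c + y))) b ≡ ⌊ b /2⌋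
count-joined-beyond-≡ {c} {x} c≤x x≢c b =
  trans (count-joined≡count-sameParity c≤x b)
        (count-alternating-false (sameParity-alternating x c) starts-false b)
  where
  starts-false : does (parity x ℙ.≟ parity (c + 0)) ≡ false
  starts-false = dec-false (parity x ℙ.≟ parity (c + 0)) (x≢c ∘ flip trans (cong parity (+-identityʳ c)))

suc-degree-hubGraph : ∀ {c n} → c ≤ n → ∀ v →
  suc (degree (hubGraph c n) v) ≡ c + count (λ y → does (joined? c (toℕ v) (c + y))) (n ∸ c)
suc-degree-hubGraph {c} {n} c≤n v = begin
  suc (degree (hubGraph c n) v)
    ≡⟨ cong suc (degree≡count (hubGraph c n) v _ (λ _ → refl)) ⟩
  suc (count (λ y → does (adjacent? c x y)) n)
    ≡⟨ count-remove _ x n (toℕ<n v) (dec-true (joined? c x x) (inj₂ (inj₂ refl))) ⟩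
  count joined n
    ≡⟨ cong (count joined) (m+[n∸m]≡n c≤n) ⟨
  count joined (c + (n ∸ c))
    ≡⟨ count-+ joined c (n ∸ c) ⟩
  count joined c + count (λ y → joined (c + y)) (n ∸ c)
    ≡⟨ cong (_+ count (λ y → joined (c + y)) (n ∸ c)) (count-all c hub-joined) ⟩
  c + count (λ y → joined (c + y)) (n ∸ c)
    ∎
  where
  open ≡-Reasoning
  x : ℕ
  x = toℕ v
  joined : ℕ → Bool
  joined y = does (joined? c x y)
  hub-joined : ∀ y → y < c → joined y ≡ true
  hub-joined y y<c = dec-true (joined? c x y) (inj₂ (inj₁ y<c))

hubGraph-minDegree : ∀ c n → suc (suc c) < n → MinDegree (hubGraph (suc c) n) (c + ⌊ n ∸ suc c /2⌋)
hubGraph-minDegree c n c+2<n = lower-bound , v₀ , attained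
  where
  c+1≤n : suc c ≤ n
  c+1≤n = ≤-trans (n≤1+n (suc c)) (<⇒≤ c+2<n)

  lower-bound : ∀ v → c + ⌊ n ∸ suc c /2⌋ ≤ degree (hubGraph (suc c) n) v
  lower-bound v = s≤s⁻¹ (subst (suc c + ⌊ n ∸ suc c /2⌋ ≤_) (sym (suc-degree-hubGraph c+1≤n v))
                    (+-monoʳ-≤ (suc c) (count-joined-beyond-≥ (suc c) (toℕ v) (n ∸ suc c))))

  v₀ : Fin n
  v₀ = fromℕ< c+2<n

  attained : degree (hubGraph (suc c) n) v₀ ≡ c + ⌊ n ∸ suc c /2⌋
  attained = suc-injective (trans (suc-degree-hubGraph c+1≤n v₀)
    (cong (suc c +_) (count-joined-beyond-≡ c+1≤v₀ v₀≢c+1 (n ∸ suc c))))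
    where
    v₀≡c+2 : toℕ v₀ ≡ suc (suc c)
    v₀≡c+2 = toℕ-fromℕ< c+2<n
    c+1≤v₀ : suc c ≤ toℕ v₀
    c+1≤v₀ = subst (suc c ≤_) (sym v₀≡c+2) (n≤1+n (suc c))
    v₀≢c+1 : parity (toℕ v₀) ≢ parity (suc c)
    v₀≢c+1 = parity-suc-≢ (suc c) ∘ trans (cong parity (sym v₀≡c+2))

-- Walking around a Hamiltonian cycle

[1+m]%n≡[1+m%n]%n : ∀ m n .{{_ : NonZero n}} → suc m % n ≡ suc (m % n) % n
[1+m]%n≡[1+m%n]%n m n =
  trans (cong (λ z → suc z % n) (m≡m%n+[m/n]*n m n)) ([m+kn]%n≡m%n (suc (m % n)) (m / n) n)

m%n≡o%n⇒o<m+n⇒o≤m : ∀ m o n .{{_ : NonZero n}} → m % n ≡ o % n → o < m + n → o ≤ m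
m%n≡o%n⇒o<m+n⇒o≤m m o n eq o<m+n = begin
  o                  ≡⟨ m≡m%n+[m/n]*n o n ⟩
  o % n + o / n * n  ≡⟨ cong (_+ o / n * n) eq ⟨
  m % n + o / n * n  ≤⟨ +-monoʳ-≤ (m % n) (*-monoˡ-≤ n o/n≤m/n) ⟩
  m % n + m / n * n  ≡⟨ m≡m%n+[m/n]*n m n ⟨
  m                  ∎
  where
  open ≤-Reasoning
  o/n≤m/n : o / n ≤ m / n
  o/n≤m/n = s≤s⁻¹ (*-cancelʳ-< n (o / n) (suc (m / n)) (+-cancelˡ-< (m % n) _ _ (begin-strict
    m % n + o / n * n        ≡⟨ cong (_+ o / n * n) eq ⟩
    o % n + o / n * n        ≡⟨ m≡m%n+[m/n]*n o n ⟨
    o                        <⟨ o<m+n ⟩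
    m + n                    ≡⟨ cong (_+ n) (m≡m%n+[m/n]*n m n) ⟩
    m % n + m / n * n + n    ≡⟨ +-assoc (m % n) (m / n * n) n ⟩
    m % n + (m / n * n + n)  ≡⟨ cong (m % n +_) (+-comm (m / n * n) n) ⟩
    m % n + suc (m / n) * n  ∎)))

module CycleWalk {n} (G : Graph n) {σ : Fin n → Fin n} (ham : IsHamCycle G σ) (s : Fin n) where

  private
    3≤n : 3 ≤ n
    3≤n = proj₁ ham
    σ-injective : Injective _≡_ _≡_ σ
    σ-injective = proj₁ (proj₂ ham)
    step : ∀ i j → toℕ j ≡ suc (toℕ i) → adj G (σ i) (σ j) ≡ true
    step = proj₁ (proj₂ (proj₂ ham))
    wrap : ∀ i j → toℕ i ≡ 0 → suc (toℕ j) ≡ n → adj G (σ j) (σ i) ≡ true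
    wrap = proj₂ (proj₂ (proj₂ ham))

    instance
      n-nonZero : NonZero n
      n-nonZero = >-nonZero (≤-trans (s≤s z≤n) 3≤n)

  position : ℕ → Fin n
  position t = fromℕ< (m%n<n (toℕ s + t) n)

  walk : ℕ → Fin n
  walk t = σ (position t)

  toℕ-position : ∀ t → toℕ (position t) ≡ (toℕ s + t) % n
  toℕ-position t = toℕ-fromℕ< _

  toℕ-position-suc : ∀ t → toℕ (position (suc t)) ≡ suc (toℕ (position t)) % n
  toℕ-position-suc t = begin
    toℕ (position (suc t))           ≡⟨ toℕ-position (suc t) ⟩
    (toℕ s + suc t) % n              ≡⟨ cong (_% n) (+-suc (toℕ s) t) ⟩
    suc (toℕ s + t) % n              ≡⟨ [1+m]%n≡[1+m%n]%n (toℕ s + t) n ⟩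
    suc ((toℕ s + t) % n) % n        ≡⟨ cong (λ r → suc r % n) (toℕ-position t) ⟨
    suc (toℕ (position t)) % n       ∎
    where open ≡-Reasoning

  walk-adjacent : ∀ t → adj G (walk t) (walk (suc t)) ≡ true
  walk-adjacent t with m≤n⇒m<n∨m≡n (toℕ<n (position t))
  ... | inj₁ 1+r<n = step (position t) (position (suc t))
                       (trans (toℕ-position-suc t) (m<n⇒m%n≡m 1+r<n))
  ... | inj₂ 1+r≡n = wrap (position (suc t)) (position t)
                       (trans (toℕ-position-suc t) (trans (cong (_% n) 1+r≡n) (n%n≡0 n))) 1+r≡n

  walk-periodic : ∀ t → walk (t + n) ≡ walk t
  walk-periodic t = cong σ (toℕ-injective (begin
    toℕ (position (t + n))   ≡⟨ toℕ-position (t + n) ⟩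
    (toℕ s + (t + n)) % n    ≡⟨ cong (_% n) (+-assoc (toℕ s) t n) ⟨
    (toℕ s + t + n) % n      ≡⟨ [m+n]%n≡m%n (toℕ s + t) n ⟩
    (toℕ s + t) % n          ≡⟨ toℕ-position t ⟨
    toℕ (position t)         ∎))
    where open ≡-Reasoning

  walk-injective-within-period : ∀ {t u} → walk t ≡ walk u → u < t + n → u ≤ t
  walk-injective-within-period {t} {u} same u<t+n = +-cancelˡ-≤ (toℕ s) u t
    (m%n≡o%n⇒o<m+n⇒o≤m (toℕ s + t) (toℕ s + u) n same-position
      (subst (toℕ s + u <_) (sym (+-assoc (toℕ s) t n)) (+-monoʳ-< (toℕ s) u<t+n)))
    where
    same-position : (toℕ s + t) % n ≡ (toℕ s + u) % n
    same-position = begin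
      (toℕ s + t) % n    ≡⟨ toℕ-position t ⟨
      toℕ (position t)   ≡⟨ cong toℕ (σ-injective same) ⟩
      toℕ (position u)   ≡⟨ toℕ-position u ⟩
      (toℕ s + u) % n    ∎
      where open ≡-Reasoning

  position-offset : ∀ t (p : Fin n) → toℕ p ≡ toℕ s + t ⊎ toℕ p + n ≡ toℕ s + t → position t ≡ p
  position-offset t p offset = toℕ-injective (trans (toℕ-position t) (reduce offset))
    where
    reduce : toℕ p ≡ toℕ s + t ⊎ toℕ p + n ≡ toℕ s + t → (toℕ s + t) % n ≡ toℕ p
    reduce (inj₁ eq) = trans (cong (_% n) (sym eq)) (m<n⇒m%n≡m (toℕ<n p))
    reduce (inj₂ eq) = trans (cong (_% n) (sym eq)) (trans ([m+n]%n≡m%n (toℕ p) n) (m<n⇒m%n≡m (toℕ<n p)))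

module _ {c n} (w : ℕ → Fin n) (w-adjacent : ∀ t → adj (hubGraph c n) (w t) (w (suc t)) ≡ true) where

  private
    label : ℕ → ℕ
    label t = toℕ (w t)

    crossing : ∀ l t → c ≤ label t → parity (label t) ≢ parity (label (l + t)) →
               ∃[ u ] t < u × u ≤ l + t × label u < c
    crossing zero    t _    differ = contradiction refl differ
    crossing (suc l) t c≤wt differ with label (suc t) <? c
    ... | yes hub = suc t , ≤-refl , s≤s (m≤n+m t l) , hub
    ... | no  off with crossing l (suc t) (≮⇒≥ off) differ′
      where
      differ′ : parity (label (suc t)) ≢ parity (label (l + suc t))
      differ′ eq = differ (begin
        parity (label t)            ≡⟨ hubGraph-edge-parity c≤wt (≮⇒≥ off) (w-adjacent t) ⟩
        parity (label (suc t))      ≡⟨ eq ⟩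
        parity (label (l + suc t))  ≡⟨ cong (parity ∘ label) (+-suc l t) ⟩
        parity (label (suc l + t))  ∎)
        where open ≡-Reasoning
    ...   | u , t+1<u , u≤ , hub = u , <⇒≤ t+1<u , subst (u ≤_) (+-suc l t) u≤ , hub

  hubGraph-crossing : ∀ {t t′} → t ≤ t′ → c ≤ toℕ (w t) → parity (toℕ (w t)) ≢ parity (toℕ (w t′)) →
                      ∃[ u ] t < u × u ≤ t′ × toℕ (w u) < c
  hubGraph-crossing {t} {t′} t≤t′ c≤wt differ
    with crossing (t′ ∸ t) t c≤wt (differ ∘ flip trans (cong (parity ∘ label) (m∸n+n≡m t≤t′)))
  ... | u , t<u , u≤ , hub = u , t<u , subst (u ≤_) (m∸n+n≡m t≤t′) u≤ , hub

-- The hub graph is not k-ordered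

hubSequence : ∀ {c k n} → c + k ≤ n → Fin k → Fin n
hubSequence {c} c+k≤n j = inject≤ (c ↑ʳ j) c+k≤n

toℕ-hubSequence : ∀ {c k n} (c+k≤n : c + k ≤ n) j → toℕ (hubSequence c+k≤n j) ≡ c + toℕ j
toℕ-hubSequence {c} c+k≤n j = trans (toℕ-inject≤ (c ↑ʳ j) c+k≤n) (toℕ-↑ʳ c j)

hubSequence-injective : ∀ {c k n} (c+k≤n : c + k ≤ n) → Injective _≡_ _≡_ (hubSequence c+k≤n)
hubSequence-injective {c} c+k≤n {i} {j} eq = ↑ʳ-injective c i j (inject≤-injective c+k≤n c+k≤n _ _ eq)

module HubSequenceCycle
  {c k n} (c-odd : parity c ≡ 1ℙ) (c<k : c < k) (c+k≤n : c + k ≤ n)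
  {σ : Fin n → Fin n} (ham : IsHamCycle (hubGraph c n) σ)
  (s : Fin n) (d : Fin k → ℕ) (d<n : ∀ j → d j < n) (d-mono : ∀ i j → toℕ i < toℕ j → d i < d j)
  (hits : ∀ j → ∃[ p ] ((toℕ p ≡ toℕ s + d j ⊎ toℕ p + n ≡ toℕ s + d j) × σ p ≡ hubSequence c+k≤n j))
  where

  open CycleWalk (hubGraph c n) ham s

  label : ℕ → ℕ
  label u = toℕ (walk u)

  label-periodic : ∀ u → label (u + n) ≡ label u
  label-periodic u = cong toℕ (walk-periodic u)

  meet : Fin (suc c) → ℕ
  meet i = d (inject≤ i c<k)

  label-meet : ∀ i → label (meet i) ≡ c + toℕ i
  label-meet i with hits (inject≤ i c<k)
  ... | p , offset , σp≡ = begin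
    toℕ (σ (position (meet i)))               ≡⟨ cong (toℕ ∘ σ) (position-offset (meet i) p offset) ⟩
    toℕ (σ p)                                 ≡⟨ cong toℕ σp≡ ⟩
    toℕ (hubSequence c+k≤n (inject≤ i c<k))   ≡⟨ toℕ-hubSequence c+k≤n (inject≤ i c<k) ⟩
    c + toℕ (inject≤ i c<k)                   ≡⟨ cong (c +_) (toℕ-inject≤ i c<k) ⟩
    c + toℕ i                                 ∎
    where open ≡-Reasoning

  meet-mono : ∀ {i j} → toℕ i ≤ toℕ j → meet i ≤ meet j
  meet-mono {i} {j} i≤j with m≤n⇒m<n∨m≡n i≤j
  ... | inj₁ i<j = <⇒≤ (d-mono _ _ (subst₂ _<_ (sym (toℕ-inject≤ i c<k)) (sym (toℕ-inject≤ j c<k)) i<j))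
  ... | inj₂ i≡j = ≤-reflexive (cong meet (toℕ-injective i≡j))

  -- Gap zero runs from S_c to S_0 one period later, gap (suc i) from S_i to S_(i+1)
  -- shifted by one period, so that the gaps follow each other in index order.
  gapStart gapEnd : Fin (suc c) → ℕ
  gapStart zero    = meet (fromℕ c)
  gapStart (suc i) = meet (inject₁ i) + n
  gapEnd   zero    = meet zero + n
  gapEnd   (suc i) = meet (suc i) + n

  gapStart≤gapEnd : ∀ i → gapStart i ≤ gapEnd i
  gapStart≤gapEnd zero    = ≤-trans (<⇒≤ (d<n _)) (m≤n+m n (meet zero))
  gapStart≤gapEnd (suc i) = +-monoˡ-≤ n (meet-mono (≤-trans (≤-reflexive (toℕ-inject₁ i)) (n≤1+n (toℕ i))))

  c≤gapStart : ∀ i → c ≤ label (gapStart i)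
  c≤gapStart zero    = subst (c ≤_) (sym (label-meet (fromℕ c))) (m≤m+n c _)
  c≤gapStart (suc i) = subst (c ≤_) (sym (trans (label-periodic _) (label-meet (inject₁ i)))) (m≤m+n c _)

  gap-parity : ∀ i → parity (label (gapStart i)) ≢ parity (label (gapEnd i))
  gap-parity zero eq = 0ℙ≢1ℙ (begin
    0ℙ                                   ≡⟨ parity-double c ⟨
    parity (c + c)                       ≡⟨ cong parity (trans (label-meet (fromℕ c)) (cong (c +_) (toℕ-fromℕ c))) ⟨
    parity (label (gapStart zero))       ≡⟨ eq ⟩
    parity (label (meet zero + n))       ≡⟨ cong parity (trans (label-periodic _) (label-meet zero)) ⟩
    parity (c + 0)                       ≡⟨ cong parity (+-identityʳ c) ⟩
    parity c                             ≡⟨ c-odd ⟩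
    1ℙ                                   ∎)
    where
    open ≡-Reasoning
    0ℙ≢1ℙ : 0ℙ ≢ 1ℙ
    0ℙ≢1ℙ ()
  gap-parity (suc i) eq = parity-suc-≢ (c + toℕ i) (begin
    parity (suc (c + toℕ i))                  ≡⟨ cong parity (+-suc c (toℕ i)) ⟨
    parity (c + suc (toℕ i))                  ≡⟨ cong parity (trans (label-periodic _) (label-meet (suc i))) ⟨
    parity (label (meet (suc i) + n))         ≡⟨ eq ⟨
    parity (label (gapStart (suc i)))         ≡⟨ cong parity (trans (label-periodic _) (label-meet (inject₁ i))) ⟩
    parity (c + toℕ (inject₁ i))              ≡⟨ cong (λ z → parity (c + z)) (toℕ-inject₁ i) ⟩
    parity (c + toℕ i)                        ∎)
    where open ≡-Reasoning

  gapEnd≤gapStart : ∀ {i j} → i Fin.< j → gapEnd i ≤ gapStart j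
  gapEnd≤gapStart {zero}  {suc j} _   = +-monoˡ-≤ n (meet-mono z≤n)
  gapEnd≤gapStart {suc i} {suc j} i<j =
    +-monoˡ-≤ n (meet-mono (subst (suc (toℕ i) ≤_) (sym (toℕ-inject₁ j)) (s≤s⁻¹ i<j)))

  gapEnd≤gapStart₀+n : ∀ i → gapEnd i ≤ gapStart zero + n
  gapEnd≤gapStart₀+n zero    = +-monoˡ-≤ n (meet-mono z≤n)
  gapEnd≤gapStart₀+n (suc i) =
    +-monoˡ-≤ n (meet-mono (subst (suc (toℕ i) ≤_) (sym (toℕ-fromℕ c)) (toℕ<n i)))

  gapStart₀≤gapStart : ∀ i → gapStart zero ≤ gapStart i
  gapStart₀≤gapStart zero    = ≤-refl
  gapStart₀≤gapStart (suc i) = ≤-trans (<⇒≤ (d<n _)) (m≤n+m n _)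

  gap : ∀ i → ∃[ u ] gapStart i < u × u ≤ gapEnd i × label u < c
  gap i = hubGraph-crossing walk walk-adjacent (gapStart≤gapEnd i) (c≤gapStart i) (gap-parity i)

  visitTime : Fin (suc c) → ℕ
  visitTime i = proj₁ (gap i)

  visitedHub : Fin (suc c) → Fin c
  visitedHub i = fromℕ< (proj₂ (proj₂ (proj₂ (gap i))))

  visitTime-ordered : ∀ {i j} → i Fin.< j → visitTime i < visitTime j
  visitTime-ordered {i} {j} i<j = begin-strict
    visitTime i  ≤⟨ proj₁ (proj₂ (proj₂ (gap i))) ⟩
    gapEnd i     ≤⟨ gapEnd≤gapStart i<j ⟩
    gapStart j   <⟨ proj₁ (proj₂ (gap j)) ⟩
    visitTime j  ∎
    where open ≤-Reasoning

  visitTime-within-period : ∀ i j → visitTime j < visitTime i + n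
  visitTime-within-period i j = begin-strict
    visitTime j        ≤⟨ proj₁ (proj₂ (proj₂ (gap j))) ⟩
    gapEnd j           ≤⟨ gapEnd≤gapStart₀+n j ⟩
    gapStart zero + n  ≤⟨ +-monoˡ-≤ n (gapStart₀≤gapStart i) ⟩
    gapStart i + n     <⟨ +-monoˡ-< n (proj₁ (proj₂ (gap i))) ⟩
    visitTime i + n    ∎
    where open ≤-Reasoning

  absurd : ⊥
  absurd with pigeonhole (n<1+n c) visitedHub
  ... | i , j , i<j , same-hub =
    <⇒≱ (visitTime-ordered i<j) (walk-injective-within-period (toℕ-injective same-label) (visitTime-within-period i j))
    where
    same-label : label (visitTime i) ≡ label (visitTime j)
    same-label = trans (sym (toℕ-fromℕ< _)) (trans (cong toℕ same-hub) (toℕ-fromℕ< _))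

hubGraph-not-kOrdered : ∀ {c k n} → parity c ≡ 1ℙ → c < k → c + k ≤ n →
                        ¬ KOrderedHamiltonian k (hubGraph c n)
hubGraph-not-kOrdered c-odd c<k c+k≤n (_ , ordered)
  with ordered (hubSequence c+k≤n) (hubSequence-injective c+k≤n)
... | _ , ham , s , d , d<n , d-mono , hits =
  HubSequenceCycle.absurd c-odd c<k c+k≤n ham s d d<n d-mono hits

⌊n/2⌋+⌊n/2⌋≤n : ∀ n → ⌊ n /2⌋ + ⌊ n /2⌋ ≤ n
⌊n/2⌋+⌊n/2⌋≤n n = ≤-trans (+-monoʳ-≤ ⌊ n /2⌋ (⌊n/2⌋≤⌈n/2⌉ n)) (≤-reflexive (⌊n/2⌋+⌈n/2⌉≡n n))

⌊m+m+n/2⌋≡m+⌊n/2⌋ : ∀ m n → ⌊ m + m + n /2⌋ ≡ m + ⌊ n /2⌋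
⌊m+m+n/2⌋≡m+⌊n/2⌋ zero    n = refl
⌊m+m+n/2⌋≡m+⌊n/2⌋ (suc m) n = trans (cong (λ z → ⌊ suc z /2⌋) (cong (_+ n) (+-suc m m)))
                                    (cong suc (⌊m+m+n/2⌋≡m+⌊n/2⌋ m n))

⌈n/2⌉+[1+m]∸2≡m+m+⌊n∸[1+m+m]/2⌋ : ∀ m n → suc (m + m) ≤ n →
                                  ⌈ n /2⌉ + suc m ∸ 2 ≡ m + m + ⌊ n ∸ suc (m + m) /2⌋
⌈n/2⌉+[1+m]∸2≡m+m+⌊n∸[1+m+m]/2⌋ m n c≤n = begin
  ⌈ n /2⌉ + suc m ∸ 2                  ≡⟨ cong (λ z → ⌈ z /2⌉ + suc m ∸ 2) (m+[n∸m]≡n c≤n) ⟨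
  suc ⌊ m + m + (n ∸ c) /2⌋ + suc m ∸ 2 ≡⟨ cong (λ z → suc z + suc m ∸ 2) (⌊m+m+n/2⌋≡m+⌊n/2⌋ m (n ∸ c)) ⟩
  m + ⌊ n ∸ c /2⌋ + suc m ∸ 1          ≡⟨ cong (_∸ 1) (+-suc (m + ⌊ n ∸ c /2⌋) m) ⟩
  m + ⌊ n ∸ c /2⌋ + m                  ≡⟨ +-assoc m _ m ⟩
  m + (⌊ n ∸ c /2⌋ + m)                ≡⟨ cong (m +_) (+-comm _ m) ⟩
  m + (m + ⌊ n ∸ c /2⌋)                ≡⟨ +-assoc m m _ ⟨
  m + m + ⌊ n ∸ c /2⌋                  ∎
  where
  open ≡-Reasoning
  c : ℕ
  c = suc (m + m)

theorem2 : ∀ (n k : ℕ) → 2 ≤ k → k ≤ ⌊ n /2⌋ →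
    ∃[ G ] (MinDegree {n} G (⌈ n /2⌉ + ⌊ k /2⌋ ∸ 2) × ¬ KOrderedHamiltonian k G)
theorem2 n k@(suc (suc k′)) (s≤s (s≤s _)) k≤n/2 =
  hubGraph c n ,
  subst (MinDegree (hubGraph c n)) (sym (⌈n/2⌉+[1+m]∸2≡m+m+⌊n∸[1+m+m]/2⌋ m n (≤-trans (m≤m+n c k) c+k≤n)))
    (hubGraph-minDegree (m + m) n c+1<n) ,
  hubGraph-not-kOrdered c-odd c<k c+k≤n
  where
  m c : ℕ
  m = ⌊ k′ /2⌋  -- ⌊ k /2⌋ reduces to suc m
  c = suc (m + m)

  c<k : c < k
  c<k = s≤s (s≤s (⌊n/2⌋+⌊n/2⌋≤n k′))

  c+k≤n : c + k ≤ n
  c+k≤n = ≤-trans (+-monoˡ-≤ k (<⇒≤ c<k)) (≤-trans (+-mono-≤ k≤n/2 k≤n/2) (⌊n/2⌋+⌊n/2⌋≤n n))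

  c+1<n : suc c < n
  c+1<n = ≤-trans (s≤s c<k) (≤-trans (+-monoˡ-≤ k (s≤s z≤n)) c+k≤n)

  c-odd : parity c ≡ 1ℙ
  c-odd = trans (parity-suc (m + m)) (cong _⁻¹ (parity-double m))
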